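{- Let $k_1,k_2,k_3\in\mathbb{Z}_{\geq 0}$ and let $(x,y,z)=(a,b,c)$ be a nonsingular positive integer solution of \[x^2+y^2+z^2+k_1xy+k_2yz+k_3zx=(3+k_1+k_2+k_3)xyz.\] Put $a'=\frac{b^2+k_2bc+c^2}{a}$, $b'=\frac{a^2+k_3ac+c^2}{b}$, $c'=\frac{a^2+k_1ab+b^2}{c}$. Then: (1) if $a$ is the maximal number in $(a,b,c)$, then $a'$ is not the maximal number in $(a',b,c)$, $b'$ is the maximal number in $(a,b',c)$, and $c'$ is the maximal number in $(a,b,c')$; (2) if $b$ is the maximal number in $(a,b,c)$, then $a'$ is the maximal number in $(a',b,c)$, $b'$ is not the maximal number in $(a,b',c)$, and $c'$ is the maximal number in $(a,b,c')$; (3) if $c$ is the maximal number in $(a,b,c)$, then $a'$ is the maximal number in $(a',b,c)$, $b'$ is the maximal number in $(a,b',c)$, and $c'$ is not the maximal number in $(a,b,c')$.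
   Context: A positive integer solution of the equation is called singular if it is one of $(1,1,1)$, $(k_2+2,1,1)$, $(1,k_3+2,1)$, $(1,1,k_1+2)$, and nonsingular otherwise. -}

module Defs where

open import Data.Nat using (ℕ; _+_; _*_; _^_; _≤_; _<_; >-nonZero)
open import Data.Nat.DivMod using (_/_)
open import Data.Product using (_×_; _,_)
open import Data.Sum using (_⊎_)
open import Relation.Binary.PropositionalEquality using (_≡_)
open import Relation.Nullary using (¬_)

IsSolution : (k₁ k₂ k₃ x y z : ℕ) → Set
IsSolution k₁ k₂ k₃ x y z =
  x ^ 2 + y ^ 2 + z ^ 2 + k₁ * x * y + k₂ * y * z + k₃ * z * x
    ≡ (3 + k₁ + k₂ + k₃) * x * y * z

Singular : (k₁ k₂ k₃ x y z : ℕ) → Set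
Singular k₁ k₂ k₃ x y z =
  ((x , y , z) ≡ (1 , 1 , 1)) ⊎
  ((x , y , z) ≡ (k₂ + 2 , 1 , 1)) ⊎
  ((x , y , z) ≡ (1 , k₃ + 2 , 1)) ⊎
  ((x , y , z) ≡ (1 , 1 , k₁ + 2))

MaxFst : (x y z : ℕ) → Set
MaxFst x y z = (y ≤ x) × (z ≤ x)

MaxSnd : (x y z : ℕ) → Set
MaxSnd x y z = (x ≤ y) × (z ≤ y)

MaxThd : (x y z : ℕ) → Set
MaxThd x y z = (x ≤ z) × (y ≤ z)

-- exact division n / d for positive d (used only when d ∣ n)
divBy : (n d : ℕ) → 0 < d → ℕ
divBy n d p = _/_ n d {{>-nonZero p}}

a′ : (k₁ k₂ k₃ a b c : ℕ) → 0 < a → ℕ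
a′ k₁ k₂ k₃ a b c pa = divBy (b ^ 2 + k₂ * b * c + c ^ 2) a pa

b′ : (k₁ k₂ k₃ a b c : ℕ) → 0 < b → ℕ
b′ k₁ k₂ k₃ a b c pb = divBy (a ^ 2 + k₃ * a * c + c ^ 2) b pb

c′ : (k₁ k₂ k₃ a b c : ℕ) → 0 < c → ℕ
c′ k₁ k₂ k₃ a b c pc = divBy (a ^ 2 + k₁ * a * b + b ^ 2) c pc

{-# OPTIONS --safe #-}
-- Viewed as a monic quadratic in its maximal coordinate x, the equation has the
-- mutation x′ = N / x as its second root (Vieta). For a nonsingular solution the
-- quadratic is negative at m = max (y , z) ≥ 2, so m lies strictly between the two
-- roots and x′ < m. The mutations at the other coordinates are at least x² / x = x.
-- The three cases are exchanged by the cyclic symmetry (a , b , c) ↦ (b , c , a),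
-- (k₁ , k₂ , k₃) ↦ (k₂ , k₃ , k₁).
module Submission where

open import Defs
open import Data.Nat using (ℕ; zero; suc; _+_; _*_; _^_; _≤_; _<_; _⊔_; z≤n; s≤s; NonZero; >-nonZero)
open import Data.Nat.DivMod using (_/_; m*n/n≡m; /-monoˡ-≤)
open import Data.Nat.Properties
open import Data.Nat.Tactic.RingSolver using (solve-∀)
open import Data.Product using (_×_; _,_; ∃-syntax; swap)
open import Data.Sum using (_⊎_; inj₁; inj₂)
open import Data.Empty using (⊥-elim)
open import Function using (_∘_)
open import Relation.Nullary using (¬_)
open import Relation.Binary.PropositionalEquality
  using (_≡_; refl; sym; trans; cong; subst; subst₂)

quadForm cubicForm : (k₁ k₂ k₃ x y z : ℕ) → ℕ
quadForm k₁ k₂ k₃ x y z = x ^ 2 + y ^ 2 + z ^ 2 + k₁ * x * y + k₂ * y * z + k₃ * z * x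
cubicForm k₁ k₂ k₃ x y z = (3 + k₁ + k₂ + k₃) * x * y * z

quadForm-in-x : ∀ k₁ k₂ k₃ x y z →
  quadForm k₁ k₂ k₃ x y z ≡ x * x + (k₁ * y + k₃ * z) * x + (y ^ 2 + k₂ * y * z + z ^ 2)
quadForm-in-x = expand
  where
  -- The ring solver does not read _^_, so x ^ 2 is written in its normal form x * (x * 1).
  expand : ∀ k₁ k₂ k₃ x y z →
    x * (x * 1) + y * (y * 1) + z * (z * 1) + k₁ * x * y + k₂ * y * z + k₃ * z * x
      ≡ x * x + (k₁ * y + k₃ * z) * x + (y * (y * 1) + k₂ * y * z + z * (z * 1))
  expand = solve-∀

cubicForm-in-x : ∀ k₁ k₂ k₃ x y z → cubicForm k₁ k₂ k₃ x y z ≡ (3 + k₁ + k₂ + k₃) * y * z * x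
cubicForm-in-x = expand
  where
  expand : ∀ k₁ k₂ k₃ x y z → (3 + k₁ + k₂ + k₃) * x * y * z ≡ (3 + k₁ + k₂ + k₃) * y * z * x
  expand = solve-∀

root⇒sum-bound : ∀ {x T N g} → 0 < x → x * x + T * x + N ≡ g * x → x + T ≤ g
root⇒sum-bound {x} {T} {N} {g} 0<x eq = *-cancelʳ-≤ (x + T) g x {{>-nonZero 0<x}} (begin
  (x + T) * x          ≡⟨ *-distribʳ-+ x x T ⟩
  x * x + T * x        ≤⟨ m≤m+n _ N ⟩
  x * x + T * x + N    ≡⟨ eq ⟩
  g * x                ∎)
  where open ≤-Reasoning

vieta-partner : ∀ {x T N g} → 0 < x → x * x + T * x + N ≡ g * x →
                ∃[ x′ ] g ≡ x + T + x′ × N ≡ x′ * x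
vieta-partner {x} {T} {N} {g} 0<x eq with m≤n⇒∃[o]m+o≡n (root⇒sum-bound {x} {T} {N} {g} 0<x eq)
... | x′ , refl = x′ , refl , +-cancelˡ-≡ (x * x + T * x) N (x′ * x) (trans eq (expand x T x′))
  where
  expand : ∀ x T x′ → (x + T + x′) * x ≡ x * x + T * x + x′ * x
  expand = solve-∀

between-roots : ∀ {m x x′} T → m ≤ x → m ≤ x′ → (x + T + x′) * m ≤ m * m + T * m + x′ * x
between-roots {m} T m≤x m≤x′ with m≤n⇒∃[o]m+o≡n m≤x | m≤n⇒∃[o]m+o≡n m≤x′
... | d , refl | e , refl = ≤-trans (m≤m+n _ (d * e)) (≤-reflexive (expand m d e T))
  where
  expand : ∀ m d e T → (m + d + T + (m + e)) * m + d * e ≡ m * m + T * m + (m + e) * (m + d)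
  expand = solve-∀

-- Negativity at m forces m strictly between the roots: x′ < m ≤ x.
partner-below : ∀ {x T N g m} (0<x : 0 < x) → x * x + T * x + N ≡ g * x →
                m * m + T * m + N < g * m → m ≤ x → divBy N x 0<x < m
partner-below {x} {T} {N} {g} {m} 0<x eq below m≤x with vieta-partner {x} {T} {N} {g} 0<x eq
... | x′ , refl , refl = subst (_< m) (sym (m*n/n≡m x′ x {{>-nonZero 0<x}}))
  (≰⇒> λ m≤x′ → <⇒≱ below (between-roots T m≤x m≤x′))

-- Termwise comparison; only q² < p² q is strict, and it needs p ≥ 2.
quadForm<cubicForm-diag : ∀ α β γ {p q} → 1 < p → 0 < q → q ≤ p →
  quadForm α β γ p p q < cubicForm α β γ p p q
quadForm<cubicForm-diag α β γ {p@(suc _)} {q@(suc _)} 1<p _ q≤p = begin-strict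
  quadForm α β γ p p q                                        ≡⟨ expand-quad α β γ p q ⟩
  (2 + α) * (p * p) + (β + γ) * (p * q) + q * q               <⟨ +-mono-≤-< (+-mono-≤ p²-term pq-term) q²-term ⟩
  (2 + α) * (p * p) * q + (β + γ) * (p * q) * p + p * p * q   ≡⟨ expand-cubic α β γ p q ⟩
  cubicForm α β γ p p q                                       ∎
  where
  open ≤-Reasoning
  p²-term : (2 + α) * (p * p) ≤ (2 + α) * (p * p) * q
  p²-term = m≤m*n ((2 + α) * (p * p)) q
  pq-term : (β + γ) * (p * q) ≤ (β + γ) * (p * q) * p
  pq-term = m≤m*n ((β + γ) * (p * q)) p
  q²-term : q * q < p * p * q
  q²-term = *-monoˡ-< q (≤-<-trans q≤p (m<m*n p p 1<p))
  expand-quad : ∀ α β γ p q →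
    p * (p * 1) + p * (p * 1) + q * (q * 1) + α * p * p + β * p * q + γ * q * p
      ≡ (2 + α) * (p * p) + (β + γ) * (p * q) + q * q
  expand-quad = solve-∀
  expand-cubic : ∀ α β γ p q →
    (2 + α) * (p * p) * q + (β + γ) * (p * q) * p + p * p * q ≡ (3 + α + β + γ) * p * p * q
  expand-cubic = solve-∀

quadForm-swap : ∀ k₁ k₂ k₃ x y z → quadForm k₁ k₂ k₃ x y z ≡ quadForm k₃ k₂ k₁ x z y
quadForm-swap = expand
  where
  expand : ∀ k₁ k₂ k₃ x y z →
    x * (x * 1) + y * (y * 1) + z * (z * 1) + k₁ * x * y + k₂ * y * z + k₃ * z * x
      ≡ x * (x * 1) + z * (z * 1) + y * (y * 1) + k₃ * x * z + k₂ * z * y + k₁ * y * x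
  expand = solve-∀

cubicForm-swap : ∀ k₁ k₂ k₃ x y z → cubicForm k₁ k₂ k₃ x y z ≡ cubicForm k₃ k₂ k₁ x z y
cubicForm-swap = expand
  where
  expand : ∀ k₁ k₂ k₃ x y z → (3 + k₁ + k₂ + k₃) * x * y * z ≡ (3 + k₃ + k₂ + k₁) * x * z * y
  expand = solve-∀

quadForm<cubicForm-at-max : ∀ k₁ k₂ k₃ {y z} → 0 < y → 0 < z → 1 < y ⊔ z →
  quadForm k₁ k₂ k₃ (y ⊔ z) y z < cubicForm k₁ k₂ k₃ (y ⊔ z) y z
quadForm<cubicForm-at-max k₁ k₂ k₃ {y} {z} 0<y 0<z 1<y⊔z with ≤-total z y
... | inj₁ z≤y = subst (λ m → quadForm k₁ k₂ k₃ m y z < cubicForm k₁ k₂ k₃ m y z) (sym y⊔z≡y)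
  (quadForm<cubicForm-diag k₁ k₂ k₃ (subst (1 <_) y⊔z≡y 1<y⊔z) 0<z z≤y)
  where
  y⊔z≡y : y ⊔ z ≡ y
  y⊔z≡y = m≥n⇒m⊔n≡m z≤y
... | inj₂ y≤z = subst (λ m → quadForm k₁ k₂ k₃ m y z < cubicForm k₁ k₂ k₃ m y z) (sym y⊔z≡z)
  (subst₂ _<_ (sym (quadForm-swap k₁ k₂ k₃ z y z)) (sym (cubicForm-swap k₁ k₂ k₃ z y z))
    (quadForm<cubicForm-diag k₃ k₂ k₁ (subst (1 <_) y⊔z≡z 1<y⊔z) 0<y y≤z))
  where
  y⊔z≡z : y ⊔ z ≡ z
  y⊔z≡z = m≤n⇒m⊔n≡n y≤z

quadratic-roots : ∀ k x → x * x + (2 + k) ≡ (3 + k) * x → x ≡ 1 ⊎ x ≡ k + 2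
quadratic-roots k zero eq = ⊥-elim (1+n≢0 (trans eq (*-zeroʳ (3 + k))))
quadratic-roots k (suc d) eq with +-cancelʳ-≡ (3 + k) (d * (2 + d)) (d * (3 + k))
  (trans (sym (expand-lhs k d)) (trans eq (expand-rhs k d)))
  where
  expand-lhs : ∀ k d → suc d * suc d + (2 + k) ≡ d * (2 + d) + (3 + k)
  expand-lhs = solve-∀
  expand-rhs : ∀ k d → (3 + k) * suc d ≡ d * (3 + k) + (3 + k)
  expand-rhs = solve-∀
... | d*[2+d]≡d*[3+k] with d
...   | zero = inj₁ refl
...   | suc d′ with *-cancelˡ-≡ (2 + suc d′) (3 + k) (suc d′) d*[2+d]≡d*[3+k]
...     | refl = inj₂ (+-comm 2 k)

unit-tail-solution : ∀ k₁ k₂ k₃ x → IsSolution k₁ k₂ k₃ x 1 1 → x ≡ 1 ⊎ x ≡ k₂ + 2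
unit-tail-solution k₁ k₂ k₃ x eq = quadratic-roots k₂ x
  (+-cancelʳ-≡ ((k₁ + k₃) * x) _ _ (trans (sym (expand-lhs k₁ k₂ k₃ x)) (trans eq (expand-rhs k₁ k₂ k₃ x))))
  where
  expand-lhs : ∀ k₁ k₂ k₃ x →
    x * (x * 1) + 1 * (1 * 1) + 1 * (1 * 1) + k₁ * x * 1 + k₂ * 1 * 1 + k₃ * 1 * x
      ≡ x * x + (2 + k₂) + (k₁ + k₃) * x
  expand-lhs = solve-∀
  expand-rhs : ∀ k₁ k₂ k₃ x → (3 + k₁ + k₂ + k₃) * x * 1 * 1 ≡ (3 + k₂) * x + (k₁ + k₃) * x
  expand-rhs = solve-∀

nonsingular⇒1<⊔ : ∀ {k₁ k₂ k₃ a b c} → IsSolution k₁ k₂ k₃ a b c → ¬ Singular k₁ k₂ k₃ a b c →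
                  0 < b → 0 < c → 1 < b ⊔ c
nonsingular⇒1<⊔ {k₁} {k₂} {k₃} {a} {suc zero} {suc zero} E ns _ _ with unit-tail-solution k₁ k₂ k₃ a E
... | inj₁ refl = ⊥-elim (ns (inj₁ refl))
... | inj₂ refl = ⊥-elim (ns (inj₂ (inj₁ refl)))
nonsingular⇒1<⊔ {b = b@(suc (suc _))} {c} _ _ _ _ = ≤-trans (s≤s (s≤s z≤n)) (m≤m⊔n b c)
nonsingular⇒1<⊔ {b = b@(suc zero)} {c@(suc (suc _))} _ _ _ _ = ≤-trans (s≤s (s≤s z≤n)) (m≤n⊔m b c)

≤-div-of-square≤ : ∀ {x y N} (0<y : 0 < y) → y ≤ x → x ^ 2 ≤ N → x ≤ divBy N y 0<y
≤-div-of-square≤ {x} {y} {N} 0<y y≤x x²≤N = begin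
  x             ≡⟨ sym (m*n/n≡m x y) ⟩
  x * y / y     ≤⟨ /-monoˡ-≤ y (≤-trans xy≤x² x²≤N) ⟩
  N / y         ∎
  where
  open ≤-Reasoning
  xy≤x² : x * y ≤ x ^ 2
  xy≤x² = *-monoʳ-≤ x (subst (y ≤_) (sym (*-identityʳ x)) y≤x)
  instance
    y≢0 : NonZero y
    y≢0 = >-nonZero 0<y

mutations-at-maxFst : ∀ {k₁ k₂ k₃ a b c} (pa : 0 < a) (pb : 0 < b) (pc : 0 < c) →
  IsSolution k₁ k₂ k₃ a b c → ¬ Singular k₁ k₂ k₃ a b c → MaxFst a b c →
  ¬ MaxFst (a′ k₁ k₂ k₃ a b c pa) b c × MaxSnd a (b′ k₁ k₂ k₃ a b c pb) c × MaxThd a b (c′ k₁ k₂ k₃ a b c pc)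
mutations-at-maxFst {k₁} {k₂} {k₃} {a} {b} {c} pa pb pc E ns (b≤a , c≤a) =
  a′-not-max , (a≤b′ , ≤-trans c≤a a≤b′) , (a≤c′ , ≤-trans b≤a a≤c′)
  where
  T N g : ℕ
  T = k₁ * b + k₃ * c
  N = b ^ 2 + k₂ * b * c + c ^ 2
  g = (3 + k₁ + k₂ + k₃) * b * c
  quadratic-in-a : a * a + T * a + N ≡ g * a
  quadratic-in-a = trans (sym (quadForm-in-x k₁ k₂ k₃ a b c)) (trans E (cubicForm-in-x k₁ k₂ k₃ a b c))
  negative-at-b⊔c : (b ⊔ c) * (b ⊔ c) + T * (b ⊔ c) + N < g * (b ⊔ c)
  negative-at-b⊔c = subst₂ _<_ (quadForm-in-x k₁ k₂ k₃ (b ⊔ c) b c) (cubicForm-in-x k₁ k₂ k₃ (b ⊔ c) b c)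
    (quadForm<cubicForm-at-max k₁ k₂ k₃ pb pc (nonsingular⇒1<⊔ E ns pb pc))
  a′-not-max : ¬ MaxFst (a′ k₁ k₂ k₃ a b c pa) b c
  a′-not-max (b≤a′ , c≤a′) =
    <⇒≱ (partner-below {T = T} {g = g} pa quadratic-in-a negative-at-b⊔c (⊔-lub b≤a c≤a)) (⊔-lub b≤a′ c≤a′)
  a≤b′ : a ≤ b′ k₁ k₂ k₃ a b c pb
  a≤b′ = ≤-div-of-square≤ pb b≤a (≤-trans (m≤m+n (a ^ 2) (k₃ * a * c)) (m≤m+n _ (c ^ 2)))
  a≤c′ : a ≤ c′ k₁ k₂ k₃ a b c pc
  a≤c′ = ≤-div-of-square≤ pc c≤a (≤-trans (m≤m+n (a ^ 2) (k₁ * a * b)) (m≤m+n _ (b ^ 2)))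

solution-rotate : ∀ k₁ k₂ k₃ a b c → IsSolution k₁ k₂ k₃ a b c → IsSolution k₂ k₃ k₁ b c a
solution-rotate k₁ k₂ k₃ a b c E =
  trans (sym (quadForm-rotate k₁ k₂ k₃ a b c)) (trans E (cubicForm-rotate k₁ k₂ k₃ a b c))
  where
  quadForm-rotate : ∀ k₁ k₂ k₃ a b c →
    a * (a * 1) + b * (b * 1) + c * (c * 1) + k₁ * a * b + k₂ * b * c + k₃ * c * a
      ≡ b * (b * 1) + c * (c * 1) + a * (a * 1) + k₂ * b * c + k₃ * c * a + k₁ * a * b
  quadForm-rotate = solve-∀
  cubicForm-rotate : ∀ k₁ k₂ k₃ a b c → (3 + k₁ + k₂ + k₃) * a * b * c ≡ (3 + k₂ + k₃ + k₁) * b * c * a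
  cubicForm-rotate = solve-∀

singular-rotate : ∀ {k₁ k₂ k₃ a b c} → Singular k₂ k₃ k₁ b c a → Singular k₁ k₂ k₃ a b c
singular-rotate (inj₁ refl)               = inj₁ refl
singular-rotate (inj₂ (inj₁ refl))        = inj₂ (inj₂ (inj₁ refl))
singular-rotate (inj₂ (inj₂ (inj₁ refl))) = inj₂ (inj₂ (inj₂ refl))
singular-rotate (inj₂ (inj₂ (inj₂ refl))) = inj₂ (inj₁ refl)

divBy-form-sym : ∀ k u v d (pd : 0 < d) →
  divBy (u ^ 2 + k * u * v + v ^ 2) d pd ≡ divBy (v ^ 2 + k * v * u + u ^ 2) d pd
divBy-form-sym k u v d pd = cong (λ n → divBy n d pd) (expand k u v)
  where
  expand : ∀ k u v → u * (u * 1) + k * u * v + v * (v * 1) ≡ v * (v * 1) + k * v * u + u * (u * 1)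
  expand = solve-∀

swap-bounds : ∀ {x y v w} → v ≡ w → x ≤ v × y ≤ v → y ≤ w × x ≤ w
swap-bounds refl = swap

mutations-at-maxSnd : ∀ {k₁ k₂ k₃ a b c} (pa : 0 < a) (pb : 0 < b) (pc : 0 < c) →
  IsSolution k₁ k₂ k₃ a b c → ¬ Singular k₁ k₂ k₃ a b c → MaxSnd a b c →
  MaxFst (a′ k₁ k₂ k₃ a b c pa) b c × ¬ MaxSnd a (b′ k₁ k₂ k₃ a b c pb) c × MaxThd a b (c′ k₁ k₂ k₃ a b c pc)
mutations-at-maxSnd {k₁} {k₂} {k₃} {a} {b} {c} pa pb pc E ns maxAt
  with mutations-at-maxFst pb pc pa (solution-rotate k₁ k₂ k₃ a b c E) (ns ∘ singular-rotate) (swap maxAt)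
... | b′-not-max , c′-max , a′-max =
  a′-max , b′-not-max ∘ swap-bounds (divBy-form-sym k₃ a c b pb) , swap-bounds (divBy-form-sym k₁ b a c pc) c′-max

mutations-at-maxThd : ∀ {k₁ k₂ k₃ a b c} (pa : 0 < a) (pb : 0 < b) (pc : 0 < c) →
  IsSolution k₁ k₂ k₃ a b c → ¬ Singular k₁ k₂ k₃ a b c → MaxThd a b c →
  MaxFst (a′ k₁ k₂ k₃ a b c pa) b c × MaxSnd a (b′ k₁ k₂ k₃ a b c pb) c × ¬ MaxThd a b (c′ k₁ k₂ k₃ a b c pc)
mutations-at-maxThd {k₁} {k₂} {k₃} {a} {b} {c} pa pb pc E ns maxAt
  with mutations-at-maxFst pc pa pb (solution-rotate k₂ k₃ k₁ b c a (solution-rotate k₁ k₂ k₃ a b c E))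
         (ns ∘ singular-rotate ∘ singular-rotate) maxAt
... | c′-not-max , a′-max , b′-max =
  swap-bounds (divBy-form-sym k₂ c b a pa) a′-max , swap-bounds (divBy-form-sym k₃ c a b pb) b′-max , c′-not-max

corollary2p4 : (k₁ k₂ k₃ a b c : ℕ) → (pa : 0 < a) → (pb : 0 < b) → (pc : 0 < c) →
    IsSolution k₁ k₂ k₃ a b c → ¬ Singular k₁ k₂ k₃ a b c →
    (MaxFst a b c →
      ¬ MaxFst (a′ k₁ k₂ k₃ a b c pa) b c × MaxSnd a (b′ k₁ k₂ k₃ a b c pb) c × MaxThd a b (c′ k₁ k₂ k₃ a b c pc))
    × (MaxSnd a b c →
      MaxFst (a′ k₁ k₂ k₃ a b c pa) b c × ¬ MaxSnd a (b′ k₁ k₂ k₃ a b c pb) c × MaxThd a b (c′ k₁ k₂ k₃ a b c pc))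
    × (MaxThd a b c →
      MaxFst (a′ k₁ k₂ k₃ a b c pa) b c × MaxSnd a (b′ k₁ k₂ k₃ a b c pb) c × ¬ MaxThd a b (c′ k₁ k₂ k₃ a b c pc))
corollary2p4 k₁ k₂ k₃ a b c pa pb pc E ns =
    mutations-at-maxFst pa pb pc E ns
  , mutations-at-maxSnd pa pb pc E ns
  , mutations-at-maxThd pa pb pc E ns
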